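{- Let $\ell$ be an odd prime, let $S$ be the subgroup of $\mathbb{F}_\ell^*$ consisting of the elements of odd order (the largest subgroup of $\mathbb{F}_\ell^*$ not containing $-1$), viewed as a central subgroup of scalar matrices in $\operatorname{GL}_2(\mathbb{F}_\ell)$, and let $\pi \colon \operatorname{GL}_2(\mathbb{F}_\ell) \to \operatorname{GL}_2(\mathbb{F}_\ell)/S$ be the projection. Let $g \in \operatorname{GL}_2(\mathbb{F}_\ell)$ and $\widetilde g = \pi(g)$. Then $\pi$ induces a bijection from the conjugacy class of $g$ in $\operatorname{GL}_2(\mathbb{F}_\ell)$ onto the conjugacy class of $\widetilde g$ in $\operatorname{GL}_2(\mathbb{F}_\ell)/S$, given by $hgh^{ -1} \mapsto \pi(hgh^{ -1})$. -}

module Defs where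

open import Data.Nat as ℕ using (ℕ; suc; zero)
open import Data.Nat.Primality using (Prime)
open import Data.Integer as ℤ using (ℤ; +_; _+_; _-_; _*_; _^_)
open import Data.Integer.Divisibility using (_∣_)
open import Data.Product using (Σ; ∃; _×_; _,_)
open import Relation.Nullary using (¬_)
open import Relation.Binary.PropositionalEquality using (_≡_)

Odd : ℕ → Set
Odd n = ∃ λ k → n ≡ suc (2 ℕ.* k)

OddPrime : ℕ → Set
OddPrime ℓ = Prime ℓ × Odd ℓ

-- The field 𝔽_ℓ is modelled as ℤ with equality taken modulo ℓ.
infix 4 _≈[_]_
_≈[_]_ : ℤ → ℕ → ℤ → Set
a ≈[ ℓ ] b = (+ ℓ) ∣ (a - b)

NonZeroMod : ℕ → ℤ → Set
NonZeroMod ℓ a = ¬ (a ≈[ ℓ ] + 0)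

IsOrder : ℕ → ℤ → ℕ → Set
IsOrder ℓ s n =
  (0 ℕ.< n) × ((s ^ n) ≈[ ℓ ] + 1) ×
  (∀ m → 0 ℕ.< m → (s ^ m) ≈[ ℓ ] + 1 → n ℕ.≤ m)

InS : ℕ → ℤ → Set
InS ℓ s = NonZeroMod ℓ s × ∃ λ n → IsOrder ℓ s n × Odd n

-- 2×2 matrices over ℤ (entries read in 𝔽_ℓ).
record M2 : Set where
  constructor mat
  field
    a b c d : ℤ
open M2 public

infixl 7 _⊗_
_⊗_ : M2 → M2 → M2
mat a₁ b₁ c₁ d₁ ⊗ mat a₂ b₂ c₂ d₂ =
  mat (a₁ * a₂ + b₁ * c₂) (a₁ * b₂ + b₁ * d₂)
      (c₁ * a₂ + d₁ * c₂) (c₁ * b₂ + d₁ * d₂)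

I₂ : M2
I₂ = mat (+ 1) (+ 0) (+ 0) (+ 1)

infixr 8 _·_
_·_ : ℤ → M2 → M2
s · mat a b c d = mat (s * a) (s * b) (s * c) (s * d)

det : M2 → ℤ
det (mat a b c d) = a * d - b * c

infix 4 _≋[_]_
_≋[_]_ : M2 → ℕ → M2 → Set
x ≋[ ℓ ] y =
  (a x ≈[ ℓ ] a y) × (b x ≈[ ℓ ] b y) × (c x ≈[ ℓ ] c y) × (d x ≈[ ℓ ] d y)

InGL2 : ℕ → M2 → Set
InGL2 ℓ x = NonZeroMod ℓ (det x)

IsInverse : ℕ → M2 → M2 → Set
IsInverse ℓ h h' = ((h ⊗ h') ≋[ ℓ ] I₂) × ((h' ⊗ h) ≋[ ℓ ] I₂)

InConjClass : ℕ → M2 → M2 → Set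
InConjClass ℓ g x =
  InGL2 ℓ x × ∃ λ h → ∃ λ h' → InGL2 ℓ h × IsInverse ℓ h h' × (x ≋[ ℓ ] ((h ⊗ g) ⊗ h'))

-- π x = π y in GL₂(𝔽_ℓ)/S, i.e. x and y differ by a scalar in S.
SameModS : ℕ → M2 → M2 → Set
SameModS ℓ x y = ∃ λ s → InS ℓ s × (x ≋[ ℓ ] (s · y))

-- π y lies in the conjugacy class of π g in GL₂(𝔽_ℓ)/S:
-- π y = π(h) π(g) π(h)⁻¹ = π(h g h⁻¹) for some h ∈ GL₂(𝔽_ℓ).
InConjClassModS : ℕ → M2 → M2 → Set
InConjClassModS ℓ g y =
  InGL2 ℓ y × ∃ λ h → ∃ λ h' → InGL2 ℓ h × IsInverse ℓ h h' × SameModS ℓ y ((h ⊗ g) ⊗ h')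

-- The projection π sends the
-- conjugacy class of g onto that of π g by definition of the quotient
-- conjugacy class; the content of the theorem is injectivity together with
-- the fact that every y with π y conjugate to π g differs from an honest
-- conjugate of g by an element of S.
--
--  * Injectivity.  If x₁ = s·x₂ with both xᵢ conjugate to g, then
--    det x₁ = det x₂ = det g is a unit and det (s·x₂) = s² det x₂, so s² = 1.
--    In the field 𝔽_ℓ this forces s = ±1, and s = -1 is impossible since s has
--    odd order n while (-1)ⁿ = -1 ≠ 1 for odd ℓ.  Hence s = 1.
--  * Lifting.  If y = s·(h g h⁻¹) with s ∈ S of order 2k+1, then
--    t = s^(2k) is the inverse of s, t again has order 2k+1 (inverses share
--    their order), and h g h⁻¹ = t·y.
module Submission where

open import Defs
open import Data.Nat as ℕ using (ℕ; suc; zero)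
import Data.Nat.Properties as ℕ
import Data.Nat.Divisibility as ℕ
open import Data.Nat.Primality using (Prime; euclidsLemma; prime⇒nonTrivial)
open import Data.Integer as ℤ using (ℤ; +_; _+_; _-_; _*_; _^_; -_)
import Data.Integer.Properties as ℤ
import Data.Integer.Divisibility.Signed as Signed
open import Data.Integer.Tactic.RingSolver using (solve-∀)
open import Data.Product using (∃; _×_; _,_; proj₁)
open import Data.Sum using (_⊎_; inj₁; inj₂)
open import Data.Empty using (⊥-elim)
open import Level using (0ℓ)
open import Relation.Nullary using (¬_)
open import Relation.Binary.Bundles using (Setoid)
open import Relation.Binary.PropositionalEquality
  using (_≡_; refl; sym; trans; cong; subst)
import Relation.Binary.Reasoning.Setoid as SetoidReasoning

^-distribʳ-* : ∀ u v m → (u * v) ^ m ≡ u ^ m * v ^ m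
^-distribʳ-* u v zero = refl
^-distribʳ-* u v (suc m) =
  trans (cong ((u * v) *_) (^-distribʳ-* u v m)) (interchange u v (u ^ m) (v ^ m))
  where
  interchange : ∀ u v x y → u * v * (x * y) ≡ u * x * (v * y)
  interchange = solve-∀

-1^odd : ∀ k → (- + 1) ^ suc (2 ℕ.* k) ≡ - + 1
-1^odd k = cong ((- + 1) *_) (trans (sym (ℤ.^-*-assoc (- + 1) 2 k)) (ℤ.^-zeroˡ k))

prime>1 : ∀ {p} → Prime p → 1 ℕ.< p
prime>1 {p} p-prime = ℕ.nonTrivial⇒n>1 p {{prime⇒nonTrivial p-prime}}

module Congruence (ℓ : ℕ) where

  -- Congruence modulo ℓ, wrapped in a record so that both sides are
  -- recoverable by type inference (the underlying divisibility is not).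
  infix 4 _≈_
  record _≈_ (u v : ℤ) : Set where
    constructor ⟨_⟩
    field un : u ≈[ ℓ ] v
  open _≈_ public

  fromDiv : ∀ {u v w} → u - v ≡ w → + ℓ Signed.∣ w → u ≈ v
  fromDiv eq ℓ∣w = ⟨ Signed.∣⇒∣ᵤ (subst (+ ℓ Signed.∣_) (sym eq) ℓ∣w) ⟩

  toDiv : ∀ {u v} → u ≈ v → + ℓ Signed.∣ (u - v)
  toDiv p = Signed.∣ᵤ⇒∣ (un p)

  ≈-refl : ∀ u → u ≈ u
  ≈-refl u = fromDiv (ℤ.+-inverseʳ u) (Signed.divides (+ 0) refl)

  ≈-reflexive : ∀ {u v} → u ≡ v → u ≈ v
  ≈-reflexive {u} refl = ≈-refl u

  ≈-sym : ∀ {u v} → u ≈ v → v ≈ u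
  ≈-sym {u} {v} p = fromDiv (swap u v) (Signed.∣m⇒∣-m (toDiv p))
    where
    swap : ∀ u v → v - u ≡ - (u - v)
    swap = solve-∀

  ≈-trans : ∀ {u v w} → u ≈ v → v ≈ w → u ≈ w
  ≈-trans {u} {v} {w} p q = fromDiv (split u v w) (Signed.∣m∣n⇒∣m+n (toDiv p) (toDiv q))
    where
    split : ∀ u v w → u - w ≡ (u - v) + (v - w)
    split = solve-∀

  ≈-setoid : Setoid 0ℓ 0ℓ
  ≈-setoid = record
    { Carrier = ℤ
    ; _≈_ = _≈_
    ; isEquivalence = record { refl = ≈-reflexive refl ; sym = ≈-sym ; trans = ≈-trans }
    }

  *-cong : ∀ {u u' v v'} → u ≈ u' → v ≈ v' → u * v ≈ u' * v'
  *-cong {u} {u'} {v} {v'} p q =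
    fromDiv (split u u' v v') (Signed.∣m∣n⇒∣m+n (Signed.∣n⇒∣m*n u (toDiv q)) (Signed.∣m⇒∣m*n v' (toDiv p)))
    where
    split : ∀ u u' v v' → u * v - u' * v' ≡ u * (v - v') + (u - u') * v'
    split = solve-∀

  *-congˡ : ∀ u {v v'} → v ≈ v' → u * v ≈ u * v'
  *-congˡ u = *-cong (≈-refl u)

  −-cong : ∀ {u u' v v'} → u ≈ u' → v ≈ v' → u - v ≈ u' - v'
  −-cong {u} {u'} {v} {v'} p q =
    fromDiv (split u u' v v') (Signed.∣m∣n⇒∣m+n (toDiv p) (Signed.∣m⇒∣-m (toDiv q)))
    where
    split : ∀ u u' v v' → (u - v) - (u' - v') ≡ (u - u') + - (v - v')
    split = solve-∀

  ^-cong : ∀ {u v} → u ≈ v → ∀ m → u ^ m ≈ v ^ m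
  ^-cong p zero = ≈-reflexive refl
  ^-cong p (suc m) = *-cong p (^-cong p m)

  ≈⇒diff≈0 : ∀ {u v} → u ≈ v → u - v ≈ + 0
  ≈⇒diff≈0 {u} {v} p = fromDiv (ℤ.+-identityʳ (u - v)) (toDiv p)

  diff≈0⇒≈ : ∀ {u v} → u - v ≈ + 0 → u ≈ v
  diff≈0⇒≈ {u} {v} p = fromDiv (sym (ℤ.+-identityʳ (u - v))) (toDiv p)

  nonZero-resp : ∀ {u v} → u ≈ v → NonZeroMod ℓ v → NonZeroMod ℓ u
  nonZero-resp {u} {v} u≈v v≉0 u≈0 = v≉0 (un {v} {+ 0} (≈-trans (≈-sym u≈v) ⟨ u≈0 ⟩))

  -- u ≈ 0 says ℓ divides |u|, the form in which Euclid's lemma applies.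
  ≈0⇒∣ : ∀ {u} → u ≈ + 0 → ℓ ℕ.∣ ℤ.∣ u ∣
  ≈0⇒∣ {u} p = subst (λ w → ℓ ℕ.∣ ℤ.∣ w ∣) (ℤ.+-identityʳ u) (un p)

  ∣⇒≈0 : ∀ {u} → ℓ ℕ.∣ ℤ.∣ u ∣ → u ≈ + 0
  ∣⇒≈0 {u} ℓ∣u = ⟨ subst (λ w → ℓ ℕ.∣ ℤ.∣ w ∣) (sym (ℤ.+-identityʳ u)) ℓ∣u ⟩

  module Field (ℓ-prime : Prime ℓ) where
    open SetoidReasoning ≈-setoid

    1≉0 : ¬ (+ 1 ≈ + 0)
    1≉0 p = ℕ.<⇒≱ (prime>1 ℓ-prime) (ℕ.∣⇒≤ (un p))

    no-zero-divisors : ∀ u v → u * v ≈ + 0 → (u ≈ + 0) ⊎ (v ≈ + 0)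
    no-zero-divisors u v uv≈0
      with euclidsLemma ℤ.∣ u ∣ ℤ.∣ v ∣ ℓ-prime (subst (ℓ ℕ.∣_) (ℤ.abs-* u v) (≈0⇒∣ uv≈0))
    ... | inj₁ ℓ∣u = inj₁ (∣⇒≈0 ℓ∣u)
    ... | inj₂ ℓ∣v = inj₂ (∣⇒≈0 ℓ∣v)

    *-cancelʳ : ∀ {u v w} → ¬ (w ≈ + 0) → u * w ≈ v * w → u ≈ v
    *-cancelʳ {u} {v} {w} w≉0 uw≈vw
      with no-zero-divisors (u - v) w (begin
             (u - v) * w   ≡⟨ factor u v w ⟩
             u * w - v * w ≈⟨ ≈⇒diff≈0 uw≈vw ⟩
             + 0           ∎)
      where
      factor : ∀ u v w → (u - v) * w ≡ u * w - v * w
      factor = solve-∀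
    ... | inj₁ u-v≈0 = diff≈0⇒≈ u-v≈0
    ... | inj₂ w≈0 = ⊥-elim (w≉0 w≈0)

    square-roots-of-1 : ∀ u → u * u ≈ + 1 → (u ≈ + 1) ⊎ (u ≈ - + 1)
    square-roots-of-1 u u²≈1
      with no-zero-divisors (u - + 1) (u - - + 1) (begin
             (u - + 1) * (u - - + 1) ≡⟨ factor u ⟩
             u * u - + 1             ≈⟨ ≈⇒diff≈0 u²≈1 ⟩
             + 0                     ∎)
      where
      factor : ∀ u → (u - + 1) * (u - - + 1) ≡ u * u - + 1
      factor = solve-∀
    ... | inj₁ u-1≈0 = inj₁ (diff≈0⇒≈ u-1≈0)
    ... | inj₂ u+1≈0 = inj₂ (diff≈0⇒≈ u+1≈0)

open Congruence

-- For odd ℓ the residues 1 and -1 are distinct: otherwise ℓ would divide 2.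
1≉-1 : ∀ {ℓ} → OddPrime ℓ → ¬ (_≈_ ℓ (+ 1) (- + 1))
1≉-1 {ℓ} (ℓ-prime , j , ℓ≡odd) p = ℕ.even≢odd 1 j (trans (sym ℓ≡2) ℓ≡odd)
  where
  ℓ≡2 : ℓ ≡ 2
  ℓ≡2 = ℕ.≤-antisym (ℕ.∣⇒≤ (un p)) (prime>1 ℓ-prime)

module OddOrder (ℓ : ℕ) where
  open SetoidReasoning (≈-setoid ℓ)
  private
    infix 4 _≈ₗ_
    _≈ₗ_ : ℤ → ℤ → Set
    _≈ₗ_ = _≈_ ℓ

  pow-transfer : ∀ {u v} → (u * v) ≈ₗ + 1 → ∀ m → (v ^ m) ≈ₗ + 1 → (u ^ m) ≈ₗ + 1
  pow-transfer {u} {v} uv≈1 m vᵐ≈1 = begin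
    u ^ m           ≡⟨ sym (ℤ.*-identityʳ (u ^ m)) ⟩
    u ^ m * + 1     ≈⟨ *-congˡ ℓ (u ^ m) (≈-sym ℓ vᵐ≈1) ⟩
    u ^ m * v ^ m   ≡⟨ sym (^-distribʳ-* u v m) ⟩
    (u * v) ^ m     ≈⟨ ^-cong ℓ uv≈1 m ⟩
    (+ 1) ^ m       ≡⟨ ℤ.^-zeroˡ m ⟩
    + 1             ∎

  inverse-order : ∀ {u v n} → (u * v) ≈ₗ + 1 → IsOrder ℓ u n → IsOrder ℓ v n
  inverse-order {u} {v} {n} uv≈1 (n>0 , uⁿ≈1 , n-least) =
    n>0 ,
    un (pow-transfer (≈-trans ℓ (≈-reflexive ℓ (ℤ.*-comm v u)) uv≈1) n ⟨ uⁿ≈1 ⟩) ,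
    λ m m>0 vᵐ≈1 → n-least m m>0 (un (pow-transfer uv≈1 m ⟨ vᵐ≈1 ⟩))

  module _ (ℓ-prime : Prime ℓ) where
    open Field ℓ ℓ-prime

    1∈S : InS ℓ (+ 1)
    1∈S = (λ p → 1≉0 ⟨ p ⟩) , 1 , (ℕ.s≤s ℕ.z≤n , un (≈-refl ℓ (+ 1)) , λ m m>0 _ → m>0) , (0 , refl)

    S-inverse-closed : ∀ {u v} → InS ℓ u → (u * v) ≈ₗ + 1 → InS ℓ v
    S-inverse-closed {u} {v} (_ , n , u-order , n-odd) uv≈1 =
      (λ v≈0 → v≉0 ⟨ v≈0 ⟩) , n , inverse-order uv≈1 u-order , n-odd
      where
      v≉0 : ¬ (v ≈ₗ + 0)
      v≉0 v≈0 = 1≉0 (begin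
        + 1     ≈⟨ ≈-sym ℓ uv≈1 ⟩
        u * v   ≈⟨ *-congˡ ℓ u v≈0 ⟩
        u * + 0 ≡⟨ ℤ.*-zeroʳ u ⟩
        + 0     ∎)

  odd-order-inverse : ∀ u k {n} → IsOrder ℓ u n → n ≡ suc (2 ℕ.* k) → (u * u ^ (2 ℕ.* k)) ≈ₗ + 1
  odd-order-inverse u k (_ , uⁿ≈1 , _) refl = ⟨ uⁿ≈1 ⟩

  -- S contains no square root of 1 besides 1 itself; this is where -1 ∉ S is used.
  S-square-root-of-1 : OddPrime ℓ → ∀ {u} → InS ℓ u → (u * u) ≈ₗ + 1 → u ≈ₗ + 1
  S-square-root-of-1 ℓ-odd-prime {u} (_ , n , (_ , uⁿ≈1 , _) , k , n≡odd) u²≈1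
    with Field.square-roots-of-1 ℓ (proj₁ ℓ-odd-prime) u u²≈1
  ... | inj₁ u≈1 = u≈1
  ... | inj₂ u≈-1 = ⊥-elim (1≉-1 ℓ-odd-prime (begin
    + 1                     ≈⟨ ≈-sym ℓ ⟨ uⁿ≈1 ⟩ ⟩
    u ^ n                   ≈⟨ ^-cong ℓ u≈-1 n ⟩
    (- + 1) ^ n             ≡⟨ cong ((- + 1) ^_) n≡odd ⟩
    (- + 1) ^ suc (2 ℕ.* k) ≡⟨ -1^odd k ⟩
    - + 1                   ∎))

module Matrices (ℓ : ℕ) where
  private
    infix 4 _≈ₗ_
    _≈ₗ_ : ℤ → ℤ → Set
    _≈ₗ_ = _≈_ ℓ

  -- Entrywise congruence of matrices, with both sides inferable.
  infix 4 _≋_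
  record _≋_ (x y : M2) : Set where
    constructor mk≋
    field
      a≈ : a x ≈ₗ a y
      b≈ : b x ≈ₗ b y
      c≈ : c x ≈ₗ c y
      d≈ : d x ≈ₗ d y

  toM : ∀ x y → x ≋[ ℓ ] y → x ≋ y
  toM _ _ (pa , pb , pc , pd) = mk≋ ⟨ pa ⟩ ⟨ pb ⟩ ⟨ pc ⟩ ⟨ pd ⟩

  fromM : ∀ {x y} → x ≋ y → x ≋[ ℓ ] y
  fromM (mk≋ pa pb pc pd) = un pa , un pb , un pc , un pd

  ≋-setoid : Setoid 0ℓ 0ℓ
  ≋-setoid = record
    { Carrier = M2
    ; _≈_ = _≋_
    ; isEquivalence = record
      { refl = mk≋ (≈-reflexive ℓ refl) (≈-reflexive ℓ refl) (≈-reflexive ℓ refl) (≈-reflexive ℓ refl)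
      ; sym = λ { (mk≋ pa pb pc pd) → mk≋ (≈-sym ℓ pa) (≈-sym ℓ pb) (≈-sym ℓ pc) (≈-sym ℓ pd) }
      ; trans = λ { (mk≋ pa pb pc pd) (mk≋ qa qb qc qd) →
                    mk≋ (≈-trans ℓ pa qa) (≈-trans ℓ pb qb) (≈-trans ℓ pc qc) (≈-trans ℓ pd qd) }
      }
    }
  open Setoid ≋-setoid public using () renaming (refl to ≋-refl)

  ·-congˡ : ∀ {u v} → u ≈ₗ v → ∀ x → u · x ≋ v · x
  ·-congˡ u≈v (mat xa xb xc xd) =
    mk≋ (*-cong ℓ u≈v (≈-refl ℓ xa)) (*-cong ℓ u≈v (≈-refl ℓ xb))
        (*-cong ℓ u≈v (≈-refl ℓ xc)) (*-cong ℓ u≈v (≈-refl ℓ xd))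

  ·-congʳ : ∀ u {x y} → x ≋ y → u · x ≋ u · y
  ·-congʳ u (mk≋ pa pb pc pd) =
    mk≋ (*-congˡ ℓ u pa) (*-congˡ ℓ u pb) (*-congˡ ℓ u pc) (*-congˡ ℓ u pd)

  ·-assoc : ∀ u v x → u · (v · x) ≡ (u * v) · x
  ·-assoc u v (mat xa xb xc xd) =
    cong₄ mat (sym (ℤ.*-assoc u v xa)) (sym (ℤ.*-assoc u v xb))
              (sym (ℤ.*-assoc u v xc)) (sym (ℤ.*-assoc u v xd))
    where
    cong₄ : ∀ (f : ℤ → ℤ → ℤ → ℤ → M2) {p p' q q' r r' s s'} →
            p ≡ p' → q ≡ q' → r ≡ r' → s ≡ s' → f p q r s ≡ f p' q' r' s'
    cong₄ f refl refl refl refl = refl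

  ·-identityˡ : ∀ x → (+ 1) · x ≡ x
  ·-identityˡ (mat xa xb xc xd)
    rewrite ℤ.*-identityˡ xa | ℤ.*-identityˡ xb | ℤ.*-identityˡ xc | ℤ.*-identityˡ xd = refl

  det-⊗ : ∀ x y → det (x ⊗ y) ≡ det x * det y
  det-⊗ (mat xa xb xc xd) (mat ya yb yc yd) = expand xa xb xc xd ya yb yc yd
    where
    expand : ∀ a b c d a' b' c' d' →
      (a * a' + b * c') * (c * b' + d * d') - (a * b' + b * d') * (c * a' + d * c')
      ≡ (a * d - b * c) * (a' * d' - b' * c')
    expand = solve-∀

  det-· : ∀ u x → det (u · x) ≡ u * u * det x
  det-· u (mat xa xb xc xd) = expand u xa xb xc xd
    where
    expand : ∀ u a b c d → u * a * (u * d) - u * b * (u * c) ≡ u * u * (a * d - b * c)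
    expand = solve-∀

  det-cong : ∀ {x y} → x ≋ y → det x ≈ₗ det y
  det-cong (mk≋ pa pb pc pd) = −-cong ℓ (*-cong ℓ pa pd) (*-cong ℓ pb pc)

  det-conj : ∀ g h h' → IsInverse ℓ h h' → det ((h ⊗ g) ⊗ h') ≈ₗ det g
  det-conj g h h' (hh'≋I , _) = begin
    det ((h ⊗ g) ⊗ h')        ≡⟨ trans (det-⊗ (h ⊗ g) h') (cong (_* det h') (det-⊗ h g)) ⟩
    det h * det g * det h'    ≡⟨ rearrange (det h) (det g) (det h') ⟩
    det g * (det h * det h')  ≡⟨ cong (det g *_) (sym (det-⊗ h h')) ⟩
    det g * det (h ⊗ h')      ≈⟨ *-congˡ ℓ (det g) (det-cong (toM (h ⊗ h') I₂ hh'≋I)) ⟩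
    det g * + 1               ≡⟨ ℤ.*-identityʳ (det g) ⟩
    det g                     ∎
    where
    open SetoidReasoning (≈-setoid ℓ)
    rearrange : ∀ p q r → p * q * r ≡ q * (p * r)
    rearrange = solve-∀

  det-of-conj : ∀ g x → InConjClass ℓ g x → det x ≈ₗ det g
  det-of-conj g x (_ , h , h' , _ , h⁻¹ , x≋hgh⁻¹) =
    ≈-trans ℓ (det-cong (toM x ((h ⊗ g) ⊗ h') x≋hgh⁻¹)) (det-conj g h h' h⁻¹)

  det-fixing-scalar : Prime ℓ → ∀ u x → InGL2 ℓ x → det (u · x) ≈ₗ det x → (u * u) ≈ₗ + 1
  det-fixing-scalar ℓ-prime u x x∈GL detux≈detx =
    Field.*-cancelʳ ℓ ℓ-prime (λ detx≈0 → x∈GL (un detx≈0)) (begin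
      u * u * det x ≡⟨ sym (det-· u x) ⟩
      det (u · x)   ≈⟨ detux≈detx ⟩
      det x         ≡⟨ sym (ℤ.*-identityˡ (det x)) ⟩
      + 1 * det x   ∎)
    where open SetoidReasoning (≈-setoid ℓ)

module Conjugacy (ℓ : ℕ) (ℓ-odd-prime : OddPrime ℓ) (g : M2) where
  open Matrices ℓ
  open OddOrder ℓ
  open SetoidReasoning ≋-setoid

  private
    ℓ-prime : Prime ℓ
    ℓ-prime = proj₁ ℓ-odd-prime

  conj⇒conjModS : (x : M2) → InConjClass ℓ g x → InConjClassModS ℓ g x
  conj⇒conjModS x (x∈GL , h , h' , h∈GL , h⁻¹ , x≋hgh⁻¹) =
    x∈GL , h , h' , h∈GL , h⁻¹ , + 1 , 1∈S ℓ-prime , fromM (begin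
      x                      ≈⟨ toM x ((h ⊗ g) ⊗ h') x≋hgh⁻¹ ⟩
      (h ⊗ g) ⊗ h'           ≡⟨ sym (·-identityˡ _) ⟩
      (+ 1) · ((h ⊗ g) ⊗ h') ∎)

  conjModS-injective : (x₁ x₂ : M2) → InConjClass ℓ g x₁ → InConjClass ℓ g x₂ →
                       SameModS ℓ x₁ x₂ → x₁ ≋[ ℓ ] x₂
  conjModS-injective x₁ x₂ x₁∼g x₂∼g@(x₂∈GL , _) (u , u∈S , x₁≋ux₂) = fromM (begin
    x₁          ≈⟨ x₁≋ₗux₂ ⟩
    u · x₂      ≈⟨ ·-congˡ u≈1 x₂ ⟩
    (+ 1) · x₂  ≡⟨ ·-identityˡ x₂ ⟩
    x₂          ∎)
    where
    x₁≋ₗux₂ : x₁ ≋ u · x₂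
    x₁≋ₗux₂ = toM x₁ (u · x₂) x₁≋ux₂
    det-ux₂≈det-x₂ : _≈_ ℓ (det (u · x₂)) (det x₂)
    det-ux₂≈det-x₂ = ≈-trans ℓ (≈-sym ℓ (det-cong x₁≋ₗux₂))
      (≈-trans ℓ (det-of-conj g x₁ x₁∼g) (≈-sym ℓ (det-of-conj g x₂ x₂∼g)))
    u≈1 : _≈_ ℓ u (+ 1)
    u≈1 = S-square-root-of-1 ℓ-odd-prime u∈S (det-fixing-scalar ℓ-prime u x₂ x₂∈GL det-ux₂≈det-x₂)

  conjModS-lift : InGL2 ℓ g → (y : M2) → InConjClassModS ℓ g y →
                  ∃ λ x → InConjClass ℓ g x × SameModS ℓ x y
  conjModS-lift g∈GL y (_ , h , h' , h∈GL , h⁻¹ , u , u∈S@(_ , _ , u-order , k , n≡odd) , y≋uX) =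
    X , (X∈GL , h , h' , h∈GL , h⁻¹ , fromM (≋-refl {X})) ,
    v , S-inverse-closed ℓ-prime u∈S uv≈1 , fromM X≋vy
    where
    X : M2
    X = (h ⊗ g) ⊗ h'
    X∈GL : InGL2 ℓ X
    X∈GL = nonZero-resp ℓ (det-conj g h h' h⁻¹) g∈GL
    -- The inverse of u, read off from its odd order.
    v : ℤ
    v = u ^ (2 ℕ.* k)
    uv≈1 : _≈_ ℓ (u * v) (+ 1)
    uv≈1 = odd-order-inverse u k u-order n≡odd
    X≋vy : X ≋ v · y
    X≋vy = begin
      X            ≡⟨ sym (·-identityˡ X) ⟩
      (+ 1) · X    ≈⟨ ·-congˡ (≈-sym ℓ (≈-trans ℓ (≈-reflexive ℓ (ℤ.*-comm v u)) uv≈1)) X ⟩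
      (v * u) · X  ≡⟨ sym (·-assoc v u X) ⟩
      v · (u · X)  ≈⟨ ·-congʳ v (Setoid.sym ≋-setoid (toM y (u · X) y≋uX)) ⟩
      v · y        ∎

mainTheorem3 : (ℓ : ℕ) → OddPrime ℓ → (g : M2) → InGL2 ℓ g →
    ((x : M2) → InConjClass ℓ g x → InConjClassModS ℓ g x)
    × ((x₁ x₂ : M2) → InConjClass ℓ g x₁ → InConjClass ℓ g x₂ → SameModS ℓ x₁ x₂ → x₁ ≋[ ℓ ] x₂)
    × ((y : M2) → InConjClassModS ℓ g y → ∃ λ x → InConjClass ℓ g x × SameModS ℓ x y)
mainTheorem3 ℓ ℓ-odd-prime g g∈GL =
  conj⇒conjModS , conjModS-injective , conjModS-lift g∈GL
  where open Conjugacy ℓ ℓ-odd-prime g
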